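{- Let $n\ge1$ and let $T$ be a key with at most $n$ rows. Then $\mathrm{cap}_n(T)$ is a key. Moreover, if $T'$ is another key, then $\mathrm{cap}_n(T)\ge T'$ if and only if $T\ge T'$ and $\max(T')\le n$.
   Context: Tableaux (fillings of Young diagrams, English convention) with positive integer entries; $T_c$ is the set of entries of column $c$. A key is a tableau whose columns are strictly increasing top to bottom and with $T_1\supseteq T_2\supseteq\cdots$ as sets. For tableaux, $T\ge T'$ means $T,T'$ have the same shape and each entry of $T$ is at least the corresponding entry of $T'$. $\max(T')$ is the largest entry. $\mathrm{cap}_n$ acts on a key with at most $n$ rows: in each column, the $k$ entries larger than $n$ are replaced by the $k$ largest elements of $[n]$ not already in that column, and the column is then sorted increasingly. -}

module Defs where

open import Data.Nat using (ℕ; suc; _≤_; _<_; _≥_; _<?_; _⊔_)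
open import Data.Nat.Properties using (_≟_)
open import Data.List using (List; []; _∷_; length; filter; map; take; upTo; downFrom; concat; foldr)
open import Data.List.Relation.Unary.All using (All)
open import Data.List.Relation.Unary.Linked using (Linked)
open import Data.List.Relation.Binary.Pointwise using (Pointwise)
open import Data.List.Membership.DecPropositional _≟_ using (_∈_; _∈?_)
open import Data.Product using (_×_)
open import Relation.Nullary using (¬?)
open import Relation.Nullary.Decidable using (_⊎-dec_)

-- A column is the list of its entries read top to bottom;
-- a tableau (English convention) is the list of its columns, left to right.
Column : Set
Column = List ℕ

Tableau : Set
Tableau = List Column

IsTableau : Tableau → Set
IsTableau T =
  All (λ c → 1 ≤ length c) T ×
  Linked (λ c d → length d ≤ length c) T ×
  All (All (λ x → 1 ≤ x)) T

IsKey : Tableau → Set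
IsKey T =
  IsTableau T ×
  All (Linked _<_) T ×
  Linked (λ c d → All (λ x → x ∈ c) d) T

AtMostRows : ℕ → Tableau → Set
AtMostRows n T = All (λ c → length c ≤ n) T

_≥T_ : Tableau → Tableau → Set
T ≥T T' = Pointwise (Pointwise _≥_) T T'

-- largest entry (0 for the empty tableau)
maxEntry : Tableau → ℕ
maxEntry T = foldr _⊔_ 0 (concat T)

-- cap_n on one column: let k = number of entries > n; the entries ≤ n are kept,
-- the k largest elements of [n] = {1..n} not in the column are added, and the
-- result (a set of distinct elements of [n]) is listed in increasing order.
capCol : ℕ → Column → Column
capCol n c = filter (λ i → (i ∈? c) ⊎-dec (i ∈? top)) (map suc (upTo n))
  where
    k : ℕ
    k = length (filter (n <?_) c)
    missing : List ℕ
    missing = filter (λ i → ¬? (i ∈? c)) (map suc (downFrom n))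
    top : List ℕ
    top = take k missing

cap : ℕ → Tableau → Tableau
cap n T = map (capCol n) T

-- Two strictly increasing columns a, b of the same length satisfy a ≥ b entrywise
-- iff for every threshold v, a has at least as many entries ≥ v as b.  Capping a
-- column c never increases these counts, and for v ≤ n it either does not lower
-- the count of c or puts all of [v, n] into the capped column.  Hence cap c ≥ c' forces
-- c ≥ c' (and c' ≤ n), while conversely for c' ≥ 1 bounded by n the threshold
-- counts of c' are dominated by those of cap c.  Nestedness of the columns
-- survives capping because a smaller column has fewer large entries and its
-- replacements, if not already in the larger column, are among the replacements
-- chosen for it.
module Submission where

open import Defs
open import Data.Nat using (ℕ; zero; suc; _+_; _≤_; _<_; _>_; _≥_; z≤n; s≤s; s≤s⁻¹)
open import Data.Nat.Properties
open import Data.List using (List; []; _∷_; length; filter; map; take; upTo; downFrom; concat; _++_)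
open import Data.List.Properties
  using (length-filter; filter-all; filter-none; filter-reject; length-map; length-upTo; length-++; length-take;
         length-removeAt′; take-take; take++drop≡id; foldr-preservesᵇ; foldr-forcesᵇ)
open import Data.List.Relation.Unary.All as All using (All; []; _∷_)
import Data.List.Relation.Unary.All.Properties as All
open import Data.List.Relation.Unary.Any using (here; there; index; _─_)
open import Data.List.Relation.Unary.Linked as Linked using (Linked; []; [-]; _∷_)
import Data.List.Relation.Unary.Linked.Properties as Linked
open import Data.List.Relation.Unary.AllPairs as AllPairs using (_∷_)
open import Data.List.Relation.Unary.Unique.Propositional using (Unique)
import Data.List.Relation.Unary.Unique.Propositional.Properties as Unique
open import Data.List.Relation.Binary.Pointwise using (Pointwise; []; _∷_; Pointwise-length)
open import Data.List.Relation.Binary.Subset.Propositional using (_⊆_)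
open import Data.List.Membership.Propositional using (_∈_; _∉_)
open import Data.List.Membership.DecPropositional _≟_ using (_∈?_)
open import Data.List.Membership.Propositional.Properties
  using (∈-filter⁺; ∈-filter⁻; ∈-map⁺; ∈-map⁻; ∈-++⁺ˡ; ∈-++⁺ʳ; ∈-++⁻; ∈-upTo⁺; ∈-upTo⁻; ∈-downFrom⁺; ∈-downFrom⁻)
open import Data.Product using (_×_; _,_; proj₁; proj₂)
open import Data.Sum using (_⊎_; inj₁; inj₂)
open import Function using (_∘_)
open import Level using (0ℓ)
open import Function.Bundles using (_⇔_; mk⇔; Equivalence)
open import Function.Construct.Composition using (_⇔-∘_)
open import Function.Construct.Identity using (⇔-id)
open import Function.Construct.Symmetry using (⇔-sym)
open import Data.Product.Function.NonDependent.Propositional using (_×-⇔_)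
open import Relation.Nullary using (¬_; yes; no; ¬?; contradiction)
open import Relation.Nullary.Decidable using (_⊎-dec_)
open import Relation.Unary using (Pred; Decidable)
open import Relation.Binary using (Rel; Transitive)
open import Relation.Binary.PropositionalEquality using (_≡_; _≢_; refl; sym; trans; cong; subst; subst₂; ≢-sym)

module _ {A : Set} where

  ∈-─⁺ : ∀ {x z : A} {xs} (x∈xs : x ∈ xs) → z ∈ xs → z ≢ x → z ∈ (xs ─ x∈xs)
  ∈-─⁺ (here refl) (here refl)  z≢x = contradiction refl z≢x
  ∈-─⁺ (here refl) (there z∈xs) _   = z∈xs
  ∈-─⁺ (there _)   (here refl)  _   = here refl
  ∈-─⁺ (there x∈xs) (there z∈xs) z≢x = there (∈-─⁺ x∈xs z∈xs z≢x)

  Unique-⊆⇒length≤ : ∀ {xs ys : List A} → Unique xs → xs ⊆ ys → length xs ≤ length ys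
  Unique-⊆⇒length≤ {[]}     _               _     = z≤n
  Unique-⊆⇒length≤ {x ∷ xs} {ys} (x∉xs ∷ u) xs⊆ys = begin
    suc (length xs)          ≤⟨ s≤s (Unique-⊆⇒length≤ u xs⊆ys─x) ⟩
    suc (length (ys ─ x∈ys)) ≡⟨ sym (length-removeAt′ ys (index x∈ys)) ⟩
    length ys                ∎
    where
    open ≤-Reasoning
    x∈ys : x ∈ ys
    x∈ys = xs⊆ys (here refl)
    xs⊆ys─x : xs ⊆ (ys ─ x∈ys)
    xs⊆ys─x z∈xs = ∈-─⁺ x∈ys (xs⊆ys (there z∈xs)) (≢-sym (All.lookup x∉xs z∈xs))

  Linked⇒All-head : ∀ {R : Rel A 0ℓ} → Transitive R → ∀ {x xs} → Linked R (x ∷ xs) → All (R x) xs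
  Linked⇒All-head R-trans l with Linked.Linked⇒AllPairs R-trans l
  ... | Rx ∷ _ = Rx

  Linked⇒Unique : ∀ {R : Rel A 0ℓ} → Transitive R → (∀ {x y} → R x y → x ≢ y) →
                  ∀ {xs} → Linked R xs → Unique xs
  Linked⇒Unique R-trans R⇒≢ l = AllPairs.map R⇒≢ (Linked.Linked⇒AllPairs R-trans l)

  ∈-take⁻ : ∀ {x : A} k xs → x ∈ take k xs → x ∈ xs
  ∈-take⁻ k xs x∈ = subst (_ ∈_) (take++drop≡id k xs) (∈-++⁺ˡ x∈)

  ∈-take-mono : ∀ {x : A} {k k′} xs → k ≤ k′ → x ∈ take k xs → x ∈ take k′ xs
  ∈-take-mono {k = k} {k′} xs k≤k′ x∈ = ∈-take⁻ k (take k′ xs) (subst (_ ∈_) take-k≡ x∈)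
    where
    take-k≡ : take k xs ≡ take k (take k′ xs)
    take-k≡ = trans (cong (λ j → take j xs) (sym (m≤n⇒m⊓n≡m k≤k′))) (sym (take-take k k′ xs))

  module _ {P Q : Pred A 0ℓ} (P? : Decidable P) (Q? : Decidable Q) where

    ∈-take-filter⁺ : ∀ {x} k xs → P x → x ∈ take k xs → x ∈ take k (filter P? xs)
    ∈-take-filter⁺ (suc k) (y ∷ xs) px x∈ with P? y | x∈
    ... | yes _  | here x≡y = here x≡y
    ... | yes _  | there x∈′ = there (∈-take-filter⁺ k xs px x∈′)
    ... | no ¬py | here refl = contradiction px ¬py
    ... | no _   | there x∈′ = ∈-take-mono (filter P? xs) (n≤1+n k) (∈-take-filter⁺ k xs px x∈′)

    filter-filter-⊆ : (∀ {x} → P x → Q x) → ∀ xs → filter P? (filter Q? xs) ≡ filter P? xs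
    filter-filter-⊆ P⊆Q []       = refl
    filter-filter-⊆ P⊆Q (x ∷ xs) with Q? x
    ... | yes _ with P? x
    ...   | yes _ = cong (x ∷_) (filter-filter-⊆ P⊆Q xs)
    ...   | no _  = filter-filter-⊆ P⊆Q xs
    filter-filter-⊆ P⊆Q (x ∷ xs) | no ¬qx with P? x
    ...   | yes px = contradiction (P⊆Q px) ¬qx
    ...   | no _   = filter-filter-⊆ P⊆Q xs

    ∈-take-filter-narrow : (∀ {x} → P x → Q x) → ∀ {x} k xs → P x →
                           x ∈ take k (filter Q? xs) → x ∈ take k (filter P? xs)
    ∈-take-filter-narrow P⊆Q k xs px x∈ =
      subst (λ ys → _ ∈ take k ys) (filter-filter-⊆ P⊆Q xs) (∈-take-filter⁺ k (filter Q? xs) px x∈)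

    length-filter-split : ∀ xs → length (filter P? xs) ≡
      length (filter P? (filter Q? xs)) + length (filter P? (filter (¬? ∘ Q?) xs))
    length-filter-split []       = refl
    length-filter-split (x ∷ xs) with Q? x
    ... | yes _ with P? x
    ...   | yes _ = cong suc (length-filter-split xs)
    ...   | no _  = length-filter-split xs
    length-filter-split (x ∷ xs) | no _ with P? x
    ...   | yes _ = trans (cong suc (length-filter-split xs)) (sym (+-suc _ _))
    ...   | no _  = length-filter-split xs

upTo₁ downFrom₁ : ℕ → List ℕ
upTo₁ n = map suc (upTo n)
downFrom₁ n = map suc (downFrom n)

∈-upTo₁⁺ : ∀ {n x} → 1 ≤ x → x ≤ n → x ∈ upTo₁ n
∈-upTo₁⁺ {x = suc _} _ x≤n = ∈-map⁺ suc (∈-upTo⁺ x≤n)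

∈-upTo₁⁻ : ∀ {n x} → x ∈ upTo₁ n → 1 ≤ x × x ≤ n
∈-upTo₁⁻ x∈ with ∈-map⁻ suc x∈
... | _ , i∈ , refl = s≤s z≤n , ∈-upTo⁻ i∈

∈-downFrom₁⁺ : ∀ {n x} → 1 ≤ x → x ≤ n → x ∈ downFrom₁ n
∈-downFrom₁⁺ {x = suc _} _ x≤n = ∈-map⁺ suc (∈-downFrom⁺ x≤n)

∈-downFrom₁⁻ : ∀ {n x} → x ∈ downFrom₁ n → 1 ≤ x × x ≤ n
∈-downFrom₁⁻ x∈ with ∈-map⁻ suc x∈
... | _ , i∈ , refl = s≤s z≤n , ∈-downFrom⁻ i∈

upTo₁-increasing : ∀ n → Linked _<_ (upTo₁ n)
upTo₁-increasing n =
  Linked.map⁺ (Linked.applyUpTo⁺₂ {R = λ i j → suc i < suc j} (λ i → i) n (λ i → n<1+n (suc i)))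

downFrom₁-decreasing : ∀ n → Linked _>_ (downFrom₁ n)
downFrom₁-decreasing n =
  Linked.map⁺ (Linked.applyDownFrom⁺₂ {R = λ i j → suc i > suc j} (λ i → i) n (λ i → n<1+n (suc i)))

length-upTo₁ : ∀ n → length (upTo₁ n) ≡ n
length-upTo₁ n = trans (length-map suc (upTo n)) (length-upTo n)

>-trans : Transitive _>_
>-trans x>y y>z = <-trans y>z x>y

increasing⇒Unique : ∀ {xs} → Linked _<_ xs → Unique xs
increasing⇒Unique = Linked⇒Unique <-trans <⇒≢

decreasing⇒Unique : ∀ {xs} → Linked _>_ xs → Unique xs
decreasing⇒Unique = Linked⇒Unique >-trans >⇒≢

take-decreasing-dichotomy : ∀ v k xs → Linked _>_ xs →
  (length (take k xs) ≡ k × All (v ≤_) (take k xs)) ⊎ (∀ {y} → y ∈ xs → v ≤ y → y ∈ take k xs)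
take-decreasing-dichotomy v zero    xs       _ = inj₁ (refl , [])
take-decreasing-dichotomy v (suc k) []       _ = inj₂ (λ ())
take-decreasing-dichotomy v (suc k) (x ∷ xs) l with v ≤? x
... | no v≰x = inj₂ λ where
      (here refl) v≤y → contradiction v≤y v≰x
      (there y∈)  v≤y → contradiction (≤-trans v≤y (<⇒≤ (All.lookup (Linked⇒All-head >-trans l) y∈))) v≰x
... | yes v≤x with take-decreasing-dichotomy v k xs (Linked.tail l)
...   | inj₁ (len≡ , v≤) = inj₁ (cong suc len≡ , v≤x ∷ v≤)
...   | inj₂ covers    = inj₂ λ where
        (here refl) _   → here refl
        (there y∈)  v≤y → there (covers y∈ v≤y)

count≥ : ℕ → List ℕ → ℕ
count≥ v xs = length (filter (v ≤?_) xs)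

count≥-all : ∀ {v xs} → All (v ≤_) xs → count≥ v xs ≡ length xs
count≥-all {v} v≤ = cong length (filter-all (v ≤?_) v≤)

count≥-above : ∀ {v n xs} → ¬ v ≤ n → All (_≤ n) xs → count≥ v xs ≡ 0
count≥-above {v} v≰n ≤n = cong length (filter-none (v ≤?_) (All.map (λ x≤n v≤x → v≰n (≤-trans v≤x x≤n)) ≤n))

count≥-⊆ : ∀ {v xs ys} → Unique xs → (∀ {z} → z ∈ xs → v ≤ z → z ∈ ys) → count≥ v xs ≤ length ys
count≥-⊆ {v} {xs} u sub = Unique-⊆⇒length≤ (Unique.filter⁺ (v ≤?_) u) λ z∈ →
  let z∈xs , v≤z = ∈-filter⁻ (v ≤?_) {xs = xs} z∈ in sub z∈xs v≤z

module _ {P : Pred ℕ 0ℓ} (P? : Decidable P) (P-up : ∀ {x y} → x ≤ y → P x → P y) where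

  length-filter-pointwise : ∀ {xs ys} → Pointwise _≥_ xs ys → length (filter P? ys) ≤ length (filter P? xs)
  length-filter-pointwise [] = z≤n
  length-filter-pointwise {x ∷ _} {y ∷ _} (y≤x ∷ ys≤xs) with P? y | P? x
  ... | yes _  | yes _   = s≤s (length-filter-pointwise ys≤xs)
  ... | yes py | no ¬px  = contradiction (P-up y≤x py) ¬px
  ... | no _   | yes _   = m≤n⇒m≤1+n (length-filter-pointwise ys≤xs)
  ... | no _   | no _    = length-filter-pointwise ys≤xs

  length-filter-∷-cancel : ∀ {x y xs ys} → y ≤ x → All (x <_) xs → length ys ≡ length xs →
    length (filter P? (y ∷ ys)) ≤ length (filter P? (x ∷ xs)) → length (filter P? ys) ≤ length (filter P? xs)
  length-filter-∷-cancel {x} {y} {xs} {ys} y≤x x<xs len≡ le with P? y | P? x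
  ... | yes _  | yes _  = s≤s⁻¹ le
  ... | yes py | no ¬px = contradiction (P-up y≤x py) ¬px
  ... | no _   | no _   = le
  ... | no _   | yes px = begin
    length (filter P? ys) ≤⟨ length-filter P? ys ⟩
    length ys             ≡⟨ len≡ ⟩
    length xs             ≡⟨ cong length (filter-all P? (All.map (λ x<z → P-up (<⇒≤ x<z) px) x<xs)) ⟨
    length (filter P? xs) ∎
    where open ≤-Reasoning

count≥-pointwise : ∀ v {xs ys} → Pointwise _≥_ xs ys → count≥ v ys ≤ count≥ v xs
count≥-pointwise v = length-filter-pointwise (v ≤?_) (λ x≤y v≤x → ≤-trans v≤x x≤y)

count≥⇒pointwise : ∀ {xs ys} → Linked _<_ xs → Linked _<_ ys → length xs ≡ length ys →
                   (∀ v → count≥ v ys ≤ count≥ v xs) → Pointwise _≥_ xs ys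
count≥⇒pointwise {[]}     {[]}     _   _   _   _ = []
count≥⇒pointwise {x ∷ xs} {y ∷ ys} lxs lys len≡ counts =
  y≤x ∷ count≥⇒pointwise (Linked.tail lxs) (Linked.tail lys) (suc-injective len≡) counts′
  where
  y≤x : y ≤ x
  y≤x with y ≤? x
  ... | yes y≤x = y≤x
  ... | no  y≰x = contradiction (begin
      suc (length xs)   ≡⟨ trans len≡ (sym (count≥-all (≤-refl ∷ All.map <⇒≤ (Linked⇒All-head <-trans lys)))) ⟩
      count≥ y (y ∷ ys) ≤⟨ counts y ⟩
      count≥ y (x ∷ xs) ≡⟨ cong length (filter-reject (y ≤?_) y≰x) ⟩
      count≥ y xs       ≤⟨ length-filter (y ≤?_) xs ⟩
      length xs         ∎) (<-irrefl refl)
    where open ≤-Reasoning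
  counts′ : ∀ v → count≥ v ys ≤ count≥ v xs
  counts′ v = length-filter-∷-cancel (v ≤?_) (λ x≤y v≤x → ≤-trans v≤x x≤y)
                y≤x (Linked⇒All-head <-trans lxs) (sym (suc-injective len≡)) (counts v)

KeyColumn : ℕ → Column → Set
KeyColumn n c = Linked _<_ c × All (1 ≤_) c × length c ≤ n

module CapCol (n : ℕ) (c : Column) where

  overflow : ℕ
  overflow = length (filter (n <?_) c)

  missing : List ℕ
  missing = filter (λ i → ¬? (i ∈? c)) (downFrom₁ n)

  fillers : List ℕ
  fillers = take overflow missing

  kept : ℕ → List ℕ
  kept v = filter (v ≤?_) (filter (λ x → ¬? (n <? x)) c)

  ∈-capCol⁺ : ∀ {x} → 1 ≤ x → x ≤ n → x ∈ c ⊎ x ∈ fillers → x ∈ capCol n c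
  ∈-capCol⁺ 1≤x x≤n = ∈-filter⁺ (λ i → (i ∈? c) ⊎-dec (i ∈? fillers)) (∈-upTo₁⁺ 1≤x x≤n)

  ∈-capCol⁻ : ∀ {x} → x ∈ capCol n c → (1 ≤ x × x ≤ n) × (x ∈ c ⊎ x ∈ fillers)
  ∈-capCol⁻ x∈ with ∈-filter⁻ (λ i → (i ∈? c) ⊎-dec (i ∈? fillers)) x∈
  ... | x∈upTo₁ , src = ∈-upTo₁⁻ x∈upTo₁ , src

  ∈-fillers⁻ : ∀ {x} → x ∈ fillers → (1 ≤ x × x ≤ n) × x ∉ c
  ∈-fillers⁻ x∈ with ∈-filter⁻ (λ i → ¬? (i ∈? c)) (∈-take⁻ overflow missing x∈)
  ... | x∈downFrom₁ , x∉c = ∈-downFrom₁⁻ x∈downFrom₁ , x∉c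

  capCol-increasing : Linked _<_ (capCol n c)
  capCol-increasing = Linked.filter⁺ _ <-trans (upTo₁-increasing n)

  capCol-positive : All (1 ≤_) (capCol n c)
  capCol-positive = All.tabulate (proj₁ ∘ proj₁ ∘ ∈-capCol⁻)

  capCol-≤n : All (_≤ n) (capCol n c)
  capCol-≤n = All.tabulate (proj₂ ∘ proj₁ ∘ ∈-capCol⁻)

  missing-decreasing : Linked _>_ missing
  missing-decreasing = Linked.filter⁺ _ >-trans (downFrom₁-decreasing n)

  length-fillers≤ : length fillers ≤ overflow
  length-fillers≤ = ≤-trans (≤-reflexive (length-take overflow missing)) (m⊓n≤m overflow _)

  count≥-split : ∀ {v} → v ≤ n → count≥ v c ≡ overflow + length (kept v)
  count≥-split {v} v≤n = trans (length-filter-split (v ≤?_) (n <?_) c) (cong (_+ length (kept v)) large≡)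
    where
    large≡ : count≥ v (filter (n <?_) c) ≡ overflow
    large≡ = count≥-all (All.map (λ n<x → ≤-trans v≤n (<⇒≤ n<x)) (All.all-filter (n <?_) c))

  ∈-kept⁻ : ∀ {v z} → z ∈ kept v → (z ∈ c × z ≤ n) × v ≤ z
  ∈-kept⁻ {v} z∈ with ∈-filter⁻ (v ≤?_) z∈
  ... | z∈small , v≤z with ∈-filter⁻ (λ x → ¬? (n <? x)) {xs = c} z∈small
  ...   | z∈c , n≮z = (z∈c , ≮⇒≥ n≮z) , v≤z

  count≥-capCol≤ : ∀ v → count≥ v (capCol n c) ≤ count≥ v c
  count≥-capCol≤ v with v ≤? n
  ... | no v≰n = ≤-trans (≤-reflexive (count≥-above v≰n capCol-≤n)) z≤n
  ... | yes v≤n = begin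
    count≥ v (capCol n c)              ≤⟨ count≥-⊆ (increasing⇒Unique capCol-increasing) large⊆ ⟩
    length (fillers ++ kept v)          ≡⟨ length-++ fillers ⟩
    length fillers + length (kept v)    ≤⟨ +-monoˡ-≤ _ length-fillers≤ ⟩
    overflow + length (kept v)          ≡⟨ sym (count≥-split v≤n) ⟩
    count≥ v c                          ∎
    where
    open ≤-Reasoning
    large⊆ : ∀ {z} → z ∈ capCol n c → v ≤ z → z ∈ fillers ++ kept v
    large⊆ z∈ v≤z with ∈-capCol⁻ z∈
    ... | (_ , z≤n′) , inj₁ z∈c =
      ∈-++⁺ʳ fillers (∈-filter⁺ (v ≤?_) (∈-filter⁺ (λ x → ¬? (n <? x)) z∈c (≤⇒≯ z≤n′)) v≤z)
    ... | _          , inj₂ z∈f = ∈-++⁺ˡ z∈f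

  -- The replacements are the largest missing values, so either they all lie
  -- above v, or they exhaust the missing values in [v, n].
  count≥-capCol-dichotomy : Linked _<_ c → All (1 ≤_) c → ∀ v → v ≤ n →
    count≥ v c ≤ count≥ v (capCol n c) ⊎ (∀ {x} → v ≤ x → 1 ≤ x → x ≤ n → x ∈ capCol n c)
  count≥-capCol-dichotomy lc pc v v≤n with take-decreasing-dichotomy v overflow missing missing-decreasing
  ... | inj₂ covers = inj₂ λ {x} v≤x 1≤x x≤n → ∈-capCol⁺ 1≤x x≤n (present-or-filler v≤x 1≤x x≤n)
    where
    present-or-filler : ∀ {x} → v ≤ x → 1 ≤ x → x ≤ n → x ∈ c ⊎ x ∈ fillers
    present-or-filler {x} v≤x 1≤x x≤n with x ∈? c
    ... | yes x∈c = inj₁ x∈c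
    ... | no  x∉c = inj₂ (covers (∈-filter⁺ (λ i → ¬? (i ∈? c)) (∈-downFrom₁⁺ 1≤x x≤n) x∉c) v≤x)
  ... | inj₁ (length≡ , v≤fillers) = inj₁ (begin
    count≥ v c                        ≡⟨ count≥-split v≤n ⟩
    overflow + length (kept v)        ≡⟨ cong (_+ length (kept v)) (sym length≡) ⟩
    length fillers + length (kept v)  ≡⟨ sym (length-++ fillers) ⟩
    length (fillers ++ kept v)        ≤⟨ Unique-⊆⇒length≤ fillers++kept-unique fillers++kept⊆ ⟩
    count≥ v (capCol n c)             ∎)
    where
    open ≤-Reasoning
    fillers++kept-unique : Unique (fillers ++ kept v)
    fillers++kept-unique = Unique.++⁺ (Unique.take⁺ overflow (decreasing⇒Unique missing-decreasing))
                      (Unique.filter⁺ (v ≤?_) (Unique.filter⁺ _ (increasing⇒Unique lc)))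
                      (λ (z∈f , z∈k) → proj₂ (∈-fillers⁻ z∈f) (proj₁ (proj₁ (∈-kept⁻ z∈k))))
    fillers++kept⊆ : fillers ++ kept v ⊆ filter (v ≤?_) (capCol n c)
    fillers++kept⊆ z∈ with ∈-++⁻ fillers z∈
    ... | inj₁ z∈f with ∈-fillers⁻ z∈f
    ...   | (1≤z , z≤n′) , _ = ∈-filter⁺ (v ≤?_) (∈-capCol⁺ 1≤z z≤n′ (inj₂ z∈f)) (All.lookup v≤fillers z∈f)
    fillers++kept⊆ z∈ | inj₂ z∈k with ∈-kept⁻ z∈k
    ...   | (z∈c , z≤n′) , v≤z = ∈-filter⁺ (v ≤?_) (∈-capCol⁺ (All.lookup pc z∈c) z≤n′ (inj₁ z∈c)) v≤z


  length-capCol : KeyColumn n c → length (capCol n c) ≡ length c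
  length-capCol (lc , pc , c≤n) = ≤-antisym shorter longer
    where
    open ≤-Reasoning
    shorter : length (capCol n c) ≤ length c
    shorter = begin
      length (capCol n c)   ≡⟨ count≥-all (All.universal (λ _ → z≤n) (capCol n c)) ⟨
      count≥ 0 (capCol n c) ≤⟨ count≥-capCol≤ 0 ⟩
      count≥ 0 c            ≡⟨ count≥-all (All.universal (λ _ → z≤n) c) ⟩
      length c              ∎
    longer : length c ≤ length (capCol n c)
    longer with 1 ≤? n
    ... | no 1≰n = ≤-trans c≤n (≤-trans (s≤s⁻¹ (≰⇒> 1≰n)) z≤n)
    ... | yes 1≤n with count≥-capCol-dichotomy lc pc 1 1≤n
    ...   | inj₁ le = begin
      length c              ≡⟨ count≥-all pc ⟨
      count≥ 1 c            ≤⟨ le ⟩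
      count≥ 1 (capCol n c) ≤⟨ length-filter (1 ≤?_) (capCol n c) ⟩
      length (capCol n c)   ∎
    ...   | inj₂ full = begin
      length c              ≤⟨ c≤n ⟩
      n                     ≡⟨ length-upTo₁ n ⟨
      length (upTo₁ n)      ≤⟨ Unique-⊆⇒length≤ (increasing⇒Unique (upTo₁-increasing n)) upTo₁⊆ ⟩
      length (capCol n c)   ∎
      where
      upTo₁⊆ : upTo₁ n ⊆ capCol n c
      upTo₁⊆ x∈ = let 1≤x , x≤n = ∈-upTo₁⁻ x∈ in full 1≤x 1≤x x≤n

capCol-preserves-⊆ : ∀ n {c d} → Linked _<_ d → All (_∈ c) d → All (_∈ capCol n c) (capCol n d)
capCol-preserves-⊆ n {c} {d} ld d⊆c = All.tabulate capCol-d⊆capCol-c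
  where
  module C = CapCol n c
  module D = CapCol n d
  overflow≤ : D.overflow ≤ C.overflow
  overflow≤ = Unique-⊆⇒length≤ (Unique.filter⁺ (n <?_) (increasing⇒Unique ld)) λ x∈ →
    let x∈d , n<x = ∈-filter⁻ (n <?_) {xs = d} x∈ in ∈-filter⁺ (n <?_) (All.lookup d⊆c x∈d) n<x
  capCol-d⊆capCol-c : capCol n d ⊆ capCol n c
  capCol-d⊆capCol-c x∈ with D.∈-capCol⁻ x∈
  ... | (1≤x , x≤n) , inj₁ x∈d = C.∈-capCol⁺ 1≤x x≤n (inj₁ (All.lookup d⊆c x∈d))
  ... | (1≤x , x≤n) , inj₂ x∈D-fillers with _ ∈? c
  ...   | yes x∈c = C.∈-capCol⁺ 1≤x x≤n (inj₁ x∈c)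
  ...   | no  x∉c = C.∈-capCol⁺ 1≤x x≤n (inj₂ (∈-take-mono C.missing overflow≤
          (∈-take-filter-narrow (λ i → ¬? (i ∈? c)) (λ i → ¬? (i ∈? d)) (λ i∉c i∈d → i∉c (All.lookup d⊆c i∈d))
            D.overflow (downFrom₁ n) x∉c x∈D-fillers)))

All-≤-pointwise : ∀ {n xs ys} → Pointwise _≥_ xs ys → All (_≤ n) xs → All (_≤ n) ys
All-≤-pointwise []            []           = []
All-≤-pointwise (y≤x ∷ ys≤xs) (x≤n ∷ xs≤n) = ≤-trans y≤x x≤n ∷ All-≤-pointwise ys≤xs xs≤n

capCol-≥⇔ : ∀ {n c c′} → KeyColumn n c → Linked _<_ c′ → All (1 ≤_) c′ →
            Pointwise _≥_ (capCol n c) c′ ⇔ (Pointwise _≥_ c c′ × All (_≤ n) c′)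
capCol-≥⇔ {n} {c} {c′} kc@(lc , pc , _) lc′ pc′ = mk⇔ to from
  where
  open CapCol n c
  to : Pointwise _≥_ (capCol n c) c′ → Pointwise _≥_ c c′ × All (_≤ n) c′
  to cap≥c′ =
    count≥⇒pointwise lc lc′ (trans (sym (length-capCol kc)) (Pointwise-length cap≥c′))
      (λ v → ≤-trans (count≥-pointwise v cap≥c′) (count≥-capCol≤ v)) ,
    All-≤-pointwise cap≥c′ capCol-≤n
  from : Pointwise _≥_ c c′ × All (_≤ n) c′ → Pointwise _≥_ (capCol n c) c′
  from (c≥c′ , c′≤n) =
    count≥⇒pointwise capCol-increasing lc′ (trans (length-capCol kc) (Pointwise-length c≥c′)) counts
    where
    counts : ∀ v → count≥ v c′ ≤ count≥ v (capCol n c)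
    counts v with v ≤? n
    ... | no v≰n = ≤-trans (≤-reflexive (count≥-above v≰n c′≤n)) z≤n
    ... | yes v≤n with count≥-capCol-dichotomy lc pc v v≤n
    ...   | inj₁ le   = ≤-trans (count≥-pointwise v c≥c′) le
    ...   | inj₂ full = count≥-⊆ (increasing⇒Unique lc′) λ z∈ v≤z →
            ∈-filter⁺ (v ≤?_) (full v≤z (All.lookup pc′ z∈) (All.lookup c′≤n z∈)) v≤z

module _ {A B : Set} where

  Linked-map⁺ : ∀ {P : Pred A 0ℓ} {R : Rel A 0ℓ} {S : Rel B 0ℓ} (f : A → B) →
    (∀ {x y} → P x → P y → R x y → S (f x) (f y)) →
    ∀ {xs} → All P xs → Linked R xs → Linked S (map f xs)
  Linked-map⁺ f pres _                []               = []
  Linked-map⁺ f pres _                [-]              = [-]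
  Linked-map⁺ f pres (px ∷ py ∷ pxs) (Rxy ∷ Rxs) = pres px py Rxy ∷ Linked-map⁺ f pres (py ∷ pxs) Rxs

  Pointwise-map⇔ : ∀ {P : Pred A 0ℓ} {Q U : Pred B 0ℓ} {R : B → B → Set} {S : A → B → Set} (f : A → B) →
    (∀ {x y} → P x → Q y → R (f x) y ⇔ (S x y × U y)) →
    ∀ {xs ys} → All P xs → All Q ys → Pointwise R (map f xs) ys ⇔ (Pointwise S xs ys × All U ys)
  Pointwise-map⇔ {P} {Q} {U} {R} {S} f h pxs qys = mk⇔ (to pxs qys) (from pxs qys)
    where
    to : ∀ {xs ys} → All P xs → All Q ys → Pointwise R (map f xs) ys → Pointwise S xs ys × All U ys
    to []          []          []          = [] , []
    to (px ∷ pxs) (qy ∷ qys) (r ∷ rs) =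
      let s , u = Equivalence.to (h px qy) r ; ss , us = to pxs qys rs in s ∷ ss , u ∷ us
    from : ∀ {xs ys} → All P xs → All Q ys → Pointwise S xs ys × All U ys → Pointwise R (map f xs) ys
    from []          []          ([] , [])         = []
    from (px ∷ pxs) (qy ∷ qys) (s ∷ ss , u ∷ us) = Equivalence.from (h px qy) (s , u) ∷ from pxs qys (ss , us)

maxEntry≤⇔ : ∀ {n} T → maxEntry T ≤ n ⇔ All (All (_≤ n)) T
maxEntry≤⇔ T = mk⇔
  (All.concat⁻ ∘ foldr-forcesᵇ (λ x y → λ x⊔y≤n → m⊔n≤o⇒m≤o x y x⊔y≤n , m⊔n≤o⇒n≤o x y x⊔y≤n) 0 (concat T))
  (foldr-preservesᵇ ⊔-lub z≤n ∘ All.concat⁺)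

keyColumns : ∀ {n T} → IsKey T → AtMostRows n T → All (KeyColumn n) T
keyColumns ((_ , _ , positive) , increasing , _) rows = All.zip (increasing , All.zip (positive , rows))

cap-isKey : ∀ n T → IsKey T → AtMostRows n T → IsKey (cap n T)
cap-isKey n T key@((nonempty , shape , _) , _ , nested) rows =
  ( All.map⁺ (All.zipWith (λ (ne , kc) → subst (1 ≤_) (sym (CapCol.length-capCol n _ kc)) ne) (nonempty , kcs))
  , Linked-map⁺ (capCol n) (λ kc kd → subst₂ _≤_ (sym (CapCol.length-capCol n _ kd)) (sym (CapCol.length-capCol n _ kc))) kcs shape
  , All.map⁺ (All.universal (CapCol.capCol-positive n) T) )
  , All.map⁺ (All.universal (CapCol.capCol-increasing n) T)
  , Linked-map⁺ (capCol n) (λ _ (ld , _) → capCol-preserves-⊆ n ld) kcs nested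
  where
  kcs : All (KeyColumn n) T
  kcs = keyColumns key rows

cap-≥⇔ : ∀ n {T T′} → IsKey T → AtMostRows n T → IsKey T′ →
         cap n T ≥T T′ ⇔ (T ≥T T′ × All (All (_≤ n)) T′)
cap-≥⇔ n key rows ((_ , _ , positive′) , increasing′ , _) =
  Pointwise-map⇔ (capCol n) (λ kc (lc′ , pc′) → capCol-≥⇔ kc lc′ pc′)
    (keyColumns key rows) (All.zip (increasing′ , positive′))

lemma3p2 : (n : ℕ) → 1 ≤ n → (T : Tableau) → IsKey T → AtMostRows n T →
    IsKey (cap n T) ×
    ((T' : Tableau) → IsKey T' → (cap n T ≥T T') ⇔ (T ≥T T' × maxEntry T' ≤ n))
lemma3p2 n _ T key rows = cap-isKey n T key rows , λ T' key′ →
  (⇔-id _ ×-⇔ ⇔-sym (maxEntry≤⇔ T')) ⇔-∘ cap-≥⇔ n key rows key′
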